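{- For every positive integer $n$: (1) $\sigma(n^2) = 2n+1$ and $\sigma(n^2-1) = 2n$; (2) $T_{2n+1}(n^2) = \{2n^2 + n + 1\}$ and $T_{2n}(n^2-1) = \{2n^2 - 1\}$.
   Context: For a nonnegative integer $a$ and a positive integer $s$, let $T_s(a)$ be the set of all positive integers $t$ with $s^2 a < t^2 < s^2(a+1)$. Let $\sigma(a)$ be the least positive integer $s$ such that $T_s(a) \neq \varnothing$ (equivalently, the smallest denominator of a rational number in the open interval $(\sqrt{a}, \sqrt{a+1})$). -}

module Defs where

open import Data.Nat using (ℕ; suc; _+_; _*_; _<_; _≤_; _^_)
open import Data.Product using (_×_; ∃-syntax)
open import Relation.Nullary using (¬_)

InT : ℕ → ℕ → ℕ → Set
InT s a t = (1 ≤ t) × ((s ^ 2 * a < t ^ 2) × (t ^ 2 < s ^ 2 * (a + 1)))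

TNonempty : ℕ → ℕ → Set
TNonempty s a = ∃[ t ] InT s a t

IsSigma : ℕ → ℕ → Set
IsSigma a s = (1 ≤ s) × (TNonempty s a × (∀ s′ → 1 ≤ s′ → s′ < s → ¬ TNonempty s′ a))

module Submission where

-- Scaling by s², a rational t/s lies in (√a, √(a+1)) iff t² lies strictly
-- between s²a and s²(a+1).  For a = n² and a = n² - 1 one endpoint of this
-- interval is itself a square (s·n)², so everything reduces to counting the
-- squares in a "window" (u², u² + d) or (u² - d, u²):
--   * a window sitting between w² and (w+1)² contains no square, and one
--     sitting between w² and (w+2)² can only contain (w+1)²;
--   * hence (u², u² + d) contains no square iff d ≤ 2u+1, exactly one square
--     (namely (u+1)²) when 2u+1 < d ≤ 4u+4; dually (u² - d, u²) contains no
--     square iff d < 2u, and only (u-1)² when 2u ≤ d ≤ 4u-4.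
-- With u = s·n and d = s² the condition s² ≤ 2sn+1 (resp. s² < 2sn) is
-- s ≤ 2n (resp. s < 2n), which gives the minimality of 2n+1 (resp. 2n); the
-- second window condition for s = 2n+1 (resp. 2n) gives the singletons.

open import Defs
open import Data.Nat using (ℕ; _+_; _*_; _∸_; _≤_; _^_)
open import Data.Product using (_×_)
open import Relation.Binary.PropositionalEquality using (_≡_)
open import Function.Bundles using (_⇔_)

open import Data.Nat using (suc; _<_; _<?_; z≤n; s≤s; >-nonZero)
open import Data.Nat.Properties
open import Data.Nat.Solver using (module +-*-Solver)
open +-*-Solver using (solve; _:+_; _:*_; _:^_; _:=_; con)
open import Data.Product using (_,_)
open import Relation.Nullary using (¬_; yes; no; contradiction)
open import Relation.Binary.PropositionalEquality
  using (refl; sym; trans; cong; subst; subst₂)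
open import Function.Bundles using (mk⇔; module Equivalence)
open Equivalence using (to; from)

square-cancel-< : ∀ {x y} → x ^ 2 < y ^ 2 → x < y
square-cancel-< {x} {y} x²<y² with x <? y
... | yes x<y = x<y
... | no x≮y = contradiction (^-monoˡ-≤ 2 (≮⇒≥ x≮y)) (<⇒≱ x²<y²)

suc-square : ∀ w → suc w ^ 2 ≡ w ^ 2 + suc (2 * w)
suc-square = solve 1 (λ w → (con 1 :+ w) :^ 2 := w :^ 2 :+ (con 1 :+ con 2 :* w)) refl

suc-suc-square : ∀ w → suc (suc w) ^ 2 ≡ w ^ 2 + 4 * suc w
suc-suc-square = solve 1 (λ w → (con 2 :+ w) :^ 2 := w :^ 2 :+ con 4 :* (con 1 :+ w)) refl

-- The open window (L, R) of the number line, in which we look for squares;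
-- InT s a t says exactly 1 ≤ t × Between (s²a) (s²(a+1)) (t²).
Between : ℕ → ℕ → ℕ → Set
Between L R x = L < x × x < R

between-cong : ∀ {L L′ R R′ x} → L ≡ L′ → R ≡ R′ → Between L R x ⇔ Between L′ R′ x
between-cong refl refl = mk⇔ (λ h → h) (λ h → h)

window-empty : ∀ {w L R t} → w ^ 2 ≤ L → R ≤ suc w ^ 2 → ¬ Between L R (t ^ 2)
window-empty {w} {t = t} w²≤L R≤ (L<t² , t²<R) =
  <⇒≱ (square-cancel-< {t} {suc w} (<-≤-trans t²<R R≤))
      (square-cancel-< {w} {t} (≤-<-trans w²≤L L<t²))

window-unique : ∀ {w L R t} → w ^ 2 ≤ L → R ≤ suc (suc w) ^ 2 → Between L R (t ^ 2) → t ≡ suc w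
window-unique {w} {t = t} w²≤L R≤ (L<t² , t²<R) =
  ≤-antisym (m<1+n⇒m≤n (square-cancel-< {t} {suc (suc w)} (<-≤-trans t²<R R≤)))
            (square-cancel-< {w} {t} (≤-<-trans w²≤L L<t²))

upper-window-empty : ∀ {u d t} → d ≤ suc (2 * u) → ¬ Between (u ^ 2) (u ^ 2 + d) (t ^ 2)
upper-window-empty {u} {t = t} d≤ =
  window-empty {u} {t = t} ≤-refl (≤-trans (+-monoʳ-≤ (u ^ 2) d≤) (≤-reflexive (sym (suc-square u))))

upper-window-unique : ∀ {u d t} → d ≤ 4 * suc u → Between (u ^ 2) (u ^ 2 + d) (t ^ 2) → t ≡ suc u
upper-window-unique {u} {t = t} d≤ =
  window-unique {u} {t = t} ≤-refl (≤-trans (+-monoʳ-≤ (u ^ 2) d≤) (≤-reflexive (sym (suc-suc-square u))))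

upper-window-member : ∀ {u d} → suc (2 * u) < d → Between (u ^ 2) (u ^ 2 + d) (suc u ^ 2)
upper-window-member {u} {d} <d =
  ^-monoˡ-< 2 (n<1+n u) , subst (_< u ^ 2 + d) (sym (suc-square u)) (+-monoʳ-< (u ^ 2) <d)

-- Lower windows (L, u²) with L + d = u².  If L + d = w² + e with d ≤ e,
-- then the window starts at or above w², so the results above apply.
lower-end : ∀ {L d w e} → L + d ≡ w ^ 2 + e → d ≤ e → w ^ 2 ≤ L
lower-end {L} {d} {w} {e} sum d≤e =
  +-cancelʳ-≤ e (w ^ 2) L (subst (_≤ L + e) sum (+-monoʳ-≤ L d≤e))

lower-window-empty : ∀ {L d u t} → L + d ≡ u ^ 2 → d < 2 * u → ¬ Between L (u ^ 2) (t ^ 2)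
lower-window-empty {d = d} {u = suc v} {t} sum d<2u =
  window-empty {v} {t = t} (lower-end {w = v} (trans sum (suc-square v)) d≤) ≤-refl
  where
  d≤ : d ≤ suc (2 * v)
  d≤ = m<1+n⇒m≤n (subst (d <_) (*-suc 2 v) d<2u)

lower-window-unique : ∀ {L d u t} → 2 ≤ u → L + d ≡ u ^ 2 → 4 + d ≤ 4 * u →
                      Between L (u ^ 2) (t ^ 2) → t ≡ u ∸ 1
lower-window-unique {d = d} {u = suc (suc w)} {t} (s≤s (s≤s z≤n)) sum 4+d≤ =
  window-unique {w} {t = t} (lower-end {w = w} (trans sum (suc-suc-square w)) d≤) ≤-refl
  where
  d≤ : d ≤ 4 * suc w
  d≤ = +-cancelˡ-≤ 4 d (4 * suc w) (subst (4 + d ≤_) (*-suc 4 (suc w)) 4+d≤)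

lower-window-member : ∀ {L d u} → 1 ≤ u → L + d ≡ u ^ 2 → 2 * u ≤ d → Between L (u ^ 2) ((u ∸ 1) ^ 2)
lower-window-member {L} {d} {suc v} (s≤s z≤n) sum 2u≤d =
  +-cancelʳ-< d L (v ^ 2) (subst (_< v ^ 2 + d) (sym (trans sum (suc-square v)))
                               (+-monoʳ-< (v ^ 2) (subst (_≤ d) (*-suc 2 v) 2u≤d)))
  , ^-monoˡ-< 2 (n<1+n v)

scaled-square : ∀ s n → s ^ 2 * n ^ 2 ≡ (s * n) ^ 2
scaled-square = solve 2 (λ s n → s :^ 2 :* n :^ 2 := (s :* n) :^ 2) refl

square-window : ∀ s n {x} →
  Between (s ^ 2 * n ^ 2) (s ^ 2 * (n ^ 2 + 1)) x ⇔ Between ((s * n) ^ 2) ((s * n) ^ 2 + s ^ 2) x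
square-window s n = between-cong (scaled-square s n)
  (solve 2 (λ s n → s :^ 2 :* (n :^ 2 :+ con 1) := (s :* n) :^ 2 :+ s :^ 2) refl s n)

pred-square-suc : ∀ {n} → 1 ≤ n → n ^ 2 ∸ 1 + 1 ≡ n ^ 2
pred-square-suc n≥1 = m∸n+n≡m (^-monoˡ-≤ 2 n≥1)

below-square-top : ∀ s {n} → 1 ≤ n → s ^ 2 * (n ^ 2 ∸ 1 + 1) ≡ (s * n) ^ 2
below-square-top s {n} n≥1 = trans (cong (s ^ 2 *_) (pred-square-suc n≥1)) (scaled-square s n)

below-square-sum : ∀ s {n} → 1 ≤ n → s ^ 2 * (n ^ 2 ∸ 1) + s ^ 2 ≡ (s * n) ^ 2
below-square-sum s {n} n≥1 =
  trans (solve 2 (λ s b → s :^ 2 :* b :+ s :^ 2 := s :^ 2 :* (b :+ con 1)) refl s (n ^ 2 ∸ 1))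
        (below-square-top s n≥1)

below-square-window : ∀ s {n x} → 1 ≤ n →
  Between (s ^ 2 * (n ^ 2 ∸ 1)) (s ^ 2 * (n ^ 2 ∸ 1 + 1)) x ⇔ Between (s ^ 2 * (n ^ 2 ∸ 1)) ((s * n) ^ 2) x
below-square-window s n≥1 = between-cong refl (below-square-top s n≥1)

square-as-product : ∀ s → s * s ≡ s ^ 2
square-as-product = solve 1 (λ s → s :* s := s :^ 2) refl

scale-double : ∀ s n → s * (2 * n) ≡ 2 * (s * n)
scale-double = solve 2 (λ s n → s :* (con 2 :* n) := con 2 :* (s :* n)) refl

square≤double : ∀ {s n} → s ≤ 2 * n → s ^ 2 ≤ 2 * (s * n)
square≤double {s} {n} s≤2n =
  subst₂ _≤_ (square-as-product s) (scale-double s n) (*-monoʳ-≤ s s≤2n)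

square<double : ∀ {s n} → 1 ≤ s → s < 2 * n → s ^ 2 < 2 * (s * n)
square<double {s} {n} s≥1 s<2n =
  subst₂ _<_ (square-as-product s) (scale-double s n) (*-monoʳ-< s {{>-nonZero s≥1}} s<2n)

positive-double : ∀ {n} → 1 ≤ n → 1 ≤ 2 * n
positive-double {n} n≥1 = ≤-trans n≥1 (m≤m+n n (n + 0))

square-T-empty : ∀ {n s} → s ≤ 2 * n → ¬ TNonempty s (n ^ 2)
square-T-empty {n} {s} s≤2n (t , _ , h) =
  upper-window-empty {s * n} {t = t} (≤-trans (square≤double s≤2n) (n≤1+n _)) (to (square-window s n) h)

square-root-closed-form : ∀ n → suc ((2 * n + 1) * n) ≡ 2 * n ^ 2 + n + 1
square-root-closed-form = solve 1 (λ n → con 1 :+ (con 2 :* n :+ con 1) :* n := con 2 :* n :^ 2 :+ n :+ con 1) refl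

square-T-unique : ∀ {n t} → InT (2 * n + 1) (n ^ 2) t → t ≡ 2 * n ^ 2 + n + 1
square-T-unique {n} {t} (_ , h) =
  trans (upper-window-unique {u} {t = t} s²≤ (to (square-window (2 * n + 1) n) h)) (square-root-closed-form n)
  where
  u = (2 * n + 1) * n
  s²≤ : (2 * n + 1) ^ 2 ≤ 4 * suc u
  s²≤ = subst ((2 * n + 1) ^ 2 ≤_)
    (solve 1 (λ n → (con 2 :* n :+ con 1) :^ 2 :+ (con 4 :* n :^ 2 :+ con 3)
                    := con 4 :* (con 1 :+ (con 2 :* n :+ con 1) :* n)) refl n)
    (m≤m+n _ _)

square-T-member : ∀ {n} → 1 ≤ n → InT (2 * n + 1) (n ^ 2) (2 * n ^ 2 + n + 1)
square-T-member {n} n≥1 =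
  subst (InT (2 * n + 1) (n ^ 2)) (square-root-closed-form n)
    (s≤s z≤n , from (square-window (2 * n + 1) n) (upper-window-member {u} <s²))
  where
  u = (2 * n + 1) * n
  <s² : suc (2 * u) < (2 * n + 1) ^ 2
  <s² = subst (suc (2 * u) <_)
    (solve 1 (λ n → con 1 :+ con 2 :* ((con 2 :* n :+ con 1) :* n) :+ con 2 :* n
                    := (con 2 :* n :+ con 1) :^ 2) refl n)
    (m<m+n (suc (2 * u)) (positive-double n≥1))

σ-square : ∀ {n} → 1 ≤ n → IsSigma (n ^ 2) (2 * n + 1)
σ-square {n} n≥1 =
  m≤n+m 1 (2 * n) , (_ , square-T-member n≥1) ,
  λ s _ s<2n+1 → square-T-empty {n} (m<1+n⇒m≤n (subst (s <_) (+-comm (2 * n) 1) s<2n+1))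

T-square : ∀ {n} → 1 ≤ n → ∀ t → InT (2 * n + 1) (n ^ 2) t ⇔ (t ≡ 2 * n ^ 2 + n + 1)
T-square {n} n≥1 t = mk⇔ (square-T-unique {n}) (λ { refl → square-T-member n≥1 })

below-T-empty : ∀ {n s} → 1 ≤ n → 1 ≤ s → s < 2 * n → ¬ TNonempty s (n ^ 2 ∸ 1)
below-T-empty {n} {s} n≥1 s≥1 s<2n (t , _ , h) =
  lower-window-empty {u = s * n} {t = t} (below-square-sum s n≥1) (square<double s≥1 s<2n)
    (to (below-square-window s n≥1) h)

double-square : ∀ n → 2 * n * n ≡ 2 * n ^ 2
double-square = solve 1 (λ n → con 2 :* n :* n := con 2 :* n :^ 2) refl

below-T-unique : ∀ {n t} → 1 ≤ n → InT (2 * n) (n ^ 2 ∸ 1) t → t ≡ 2 * n ^ 2 ∸ 1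
below-T-unique {n} {t} n≥1 (_ , h) =
  trans (lower-window-unique {u = 2 * n * n} {t = t} 2≤u (below-square-sum (2 * n) n≥1) 4+s²≤
                             (to (below-square-window (2 * n) n≥1) h))
        (cong (_∸ 1) (double-square n))
  where
  2≤u : 2 ≤ 2 * n * n
  2≤u = *-mono-≤ (*-monoʳ-≤ 2 n≥1) n≥1
  4+s²≤ : 4 + (2 * n) ^ 2 ≤ 4 * (2 * n * n)
  4+s²≤ = subst (4 + (2 * n) ^ 2 ≤_)
    (solve 1 (λ n → con 4 :* n :^ 2 :+ (con 2 :* n) :^ 2 := con 4 :* (con 2 :* n :* n)) refl n)
    (+-monoˡ-≤ ((2 * n) ^ 2) (*-monoʳ-≤ 4 (^-monoˡ-≤ 2 n≥1)))

below-T-member : ∀ {n} → 1 ≤ n → InT (2 * n) (n ^ 2 ∸ 1) (2 * n ^ 2 ∸ 1)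
below-T-member {n} n≥1 =
  ∸-monoˡ-≤ 1 (*-monoʳ-≤ 2 (^-monoˡ-≤ 2 n≥1)) ,
  from (below-square-window (2 * n) n≥1)
    (subst (λ u → Between ((2 * n) ^ 2 * (n ^ 2 ∸ 1)) ((2 * n * n) ^ 2) ((u ∸ 1) ^ 2)) (double-square n)
      (lower-window-member {u = 2 * n * n} (*-mono-≤ (positive-double n≥1) n≥1) (below-square-sum (2 * n) n≥1)
        (≤-reflexive (solve 1 (λ n → con 2 :* (con 2 :* n :* n) := (con 2 :* n) :^ 2) refl n))))

σ-below-square : ∀ {n} → 1 ≤ n → IsSigma (n ^ 2 ∸ 1) (2 * n)
σ-below-square {n} n≥1 =
  positive-double n≥1 , (_ , below-T-member n≥1) , λ s s≥1 s<2n → below-T-empty {n} n≥1 s≥1 s<2n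

T-below-square : ∀ {n} → 1 ≤ n → ∀ t → InT (2 * n) (n ^ 2 ∸ 1) t ⇔ (t ≡ 2 * n ^ 2 ∸ 1)
T-below-square {n} n≥1 t = mk⇔ (below-T-unique {n} n≥1) (λ { refl → below-T-member n≥1 })

corollary1 : ∀ (n : ℕ) → 1 ≤ n →
    (IsSigma (n ^ 2) (2 * n + 1) × IsSigma (n ^ 2 ∸ 1) (2 * n))
    × ((∀ t → InT (2 * n + 1) (n ^ 2) t ⇔ (t ≡ 2 * n ^ 2 + n + 1))
       × (∀ t → InT (2 * n) (n ^ 2 ∸ 1) t ⇔ (t ≡ 2 * n ^ 2 ∸ 1)))
corollary1 n n≥1 =
  (σ-square n≥1 , σ-below-square n≥1) , (T-square n≥1 , T-below-square n≥1)
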